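{- Let $n\in\{3,4\}$, rationals $0<r_1\le\cdots\le r_{n-1}<1$, and rationals $r_n,q_n$ with $0<r_n<q_n\le1$ and $r_2<q_n$; let $\mathit{HD}$ have parameters $\boldsymbol{\alpha}=\{r_1,\dots,r_n\}$, $\boldsymbol{\beta}=\{1,\dots,1,q_n\}$, and $M=M(\mathit{HD})$. Let $\gamma_n=-1+q_n-r_n$ and $A_{\gamma_n}(k)=(-\gamma_n)_k/k!$. Then for each prime $p\equiv1\pmod M$, $$A_{\gamma_n}((p-1)r_n)\equiv\frac{\Gamma_p(r_n)\Gamma_p(q_n-r_n)}{\Gamma_p(q_n)}\equiv-J_{\bar\omega_p}(r_n,q_n-r_n)\pmod p.$$
   Context: $(a)_k=a(a+1)\cdots(a+k-1)$. $M(\mathit{HD})$ is the least positive common denominator of all parameters. $\Gamma_p$ is Morita's $p$-adic gamma function ($\Gamma_p(n)=(-1)^n\prod_{1\le i\le n-1,p\nmid i}i$ on positive integers, extended continuously to $\mathbb{Z}_p$). $\omega_p$ is the Teichmüller character of $\mathbb{F}_p^\times$ (values in $\mathbb{Z}_p$), all characters extended by $0$ at $0$, and for $a,b\in\frac1M\mathbb{Z}$, $J_{\bar\omega_p}(a,b)=\sum_{x\in\mathbb{F}_p}\bar\omega_p^{(p-1)a}(x)\,\bar\omega_p^{(p-1)b}(1-x)\in\mathbb{Z}_p$. -}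

module Defs where

open import Data.Nat as ℕ using (ℕ; zero; suc; _∸_; _!)
open import Data.Nat.Properties using (_!≢0)
open import Data.Nat.LCM using (lcm)
open import Data.Nat.Divisibility using (_∣?_)
open import Data.Integer as ℤ using (ℤ; +_; -[1+_])
open import Data.Integer.DivMod using (_%ℕ_)
import Data.Integer.Divisibility as ℤD
open import Data.Rational as ℚ using (ℚ)
open import Data.List using (List; foldr)
open import Relation.Nullary using (yes; no)

poch : ℚ → ℕ → ℚ
poch a zero    = ℚ.1ℚ
poch a (suc k) = poch a k ℚ.* (a ℚ.+ (+ k ℚ./ 1))

Aγ : ℚ → ℕ → ℚ
Aγ γ k = poch (ℚ.- γ) k ℚ.* ((+ 1) ℚ./ (k !)) {{k !≢0}}

Mof : List ℚ → ℕ
Mof = foldr (λ x m → lcm (ℚ.denominatorℕ x) m) 1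

infix 4 _≡_[mod_]
_≡_[mod_] : ℤ → ℤ → ℕ → Set
a ≡ b [mod p ] = (+ p) ℤD.∣ (a ℤ.- b)

-- Reduction mod p of a p-integral rational x = u/v (p ∤ v): u · v^(p-2),
-- i.e. u · v⁻¹ in 𝔽_p for p prime (Fermat inverse).
redℚ : ℕ → ℚ → ℤ
redℚ p x = ℚ.numerator x ℤ.* (+ (ℚ.denominatorℕ x ℕ.^ (p ∸ 2)))

invmod : ℕ → ℤ → ℤ
invmod p y = y ℤ.^ (p ∸ 2)

-- Morita's p-adic gamma function on positive integers:
-- Γ_p(N) = (-1)^N ∏_{1 ≤ i ≤ N-1, p ∤ i} i.
prodCoprime : ℕ → ℕ → ℤ
prodCoprime p zero    = + 1
prodCoprime p (suc m) with p ∣? suc m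
... | yes _ = prodCoprime p m
... | no  _ = prodCoprime p m ℤ.* (+ suc m)

Γpℕ : ℕ → ℕ → ℤ
Γpℕ p N = (ℤ.- (+ 1)) ℤ.^ N ℤ.* prodCoprime p (N ∸ 1)

-- Γ_p(x) mod p for a p-integral rational x: Γ_p(N) for the positive integer
-- representative N ∈ {1,…,p} of x mod p (Γ_p is continuous and
-- Γ_p(x) ≡ Γ_p(N) mod p whenever x ≡ N mod p, p odd).
Γpmod : ℕ → ℚ → ℤ
Γpmod zero    x = + 0
Γpmod p@(suc _) x = Γpℕ p (suc ((redℚ p x ℤ.- (+ 1)) %ℕ p))

-- Reduction mod p of the Teichmüller power ω̄_p^e(y) = ω_p(y)^(-e)
-- (extended by 0 at 0).  Since ω_p(y) ≡ y mod p, this is y^(-e) in 𝔽_p,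
-- with y⁻¹ = y^(p-2).
ω̄pow : ℕ → ℤ → ℤ → ℤ
ω̄pow p e y with p ∣? ℤ.∣ y ∣
... | yes _ = + 0
ω̄pow p (+ m)      y | no _ = y ℤ.^ ((p ∸ 2) ℕ.* m)
ω̄pow p -[1+ m ]   y | no _ = y ℤ.^ (suc m)

-- the integer (p-1)·a (for a ∈ (1/M)ℤ and M ∣ p-1 this is exact)
expo : ℕ → ℚ → ℤ
expo p a = ℚ.numerator ((+ (p ∸ 1) ℚ./ 1) ℚ.* a)

sumTo : ℕ → (ℕ → ℤ) → ℤ
sumTo zero    f = + 0
sumTo (suc m) f = sumTo m f ℤ.+ f m

Jmod : ℕ → ℚ → ℚ → ℤ
Jmod p a b = sumTo p (λ x → ω̄pow p (expo p a) (+ x) ℤ.* ω̄pow p (expo p b) ((+ 1) ℤ.- (+ x)))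

-- Put m = p - 1. The denominators of rn and qn divide m, so rn = a/m and qn = (a + c)/m with
-- 1 ≤ a, 1 ≤ c, a + c ≤ m, and modulo p they reduce to -a and -(a + c). Each of the three
-- quantities, multiplied by a! c!, is then congruent to (a + c)!, and a! c! is invertible mod p:
-- * A_γ(a) = (1 + c)_a / a!, because -γ reduces to 1 + c;
-- * Γ_p(-k) ≡ 1/k! for k ≤ m, by Wilson's theorem in the form (-1)^k k! (m - k)! ≡ -1;
-- * expanding (1 - x)^(m - c) binomially writes J(rn, qn - rn) through the power sums
--   Σ_x x^j, which vanish mod p unless m ∣ j > 0; what survives is -C(m - c, a) (-1)^a,
--   and C(m - c, a) (-1)^a ≡ C(-1 - c, a) (-1)^a = (a + c)!/(a! c!).
-- Wilson's theorem itself follows from the same power sums: the monic polynomial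
-- x (x - 1) ⋯ (x - m + 1) of degree m sums to m! over 𝔽_p, and also to Σ_x x^m ≡ -1.

module Submission where

open import Defs
open import Data.Nat as ℕ using (ℕ; _∸_)
open import Data.Nat.Divisibility using (_∣_)
open import Data.Nat.Primality using (Prime)
open import Data.Fin using (Fin; toℕ; _≤_)
open import Data.Integer as ℤ using (ℤ)
open import Data.Rational as ℚ using (ℚ; 0ℚ; 1ℚ)
open import Data.List using (List; _∷_; []; _++_; replicate)
open import Data.Vec.Functional using (toList)
open import Data.Sum using (_⊎_)
open import Data.Product using (_×_)
open import Relation.Binary.PropositionalEquality using (_≡_)

open import Data.Nat using (zero; suc; z≤n; s≤s; _!)
open import Data.Nat.Combinatorics
  using (_C_; nCn≡1; k>n⇒nCk≡0; nCk≡n!/k![n-k]!; k![n∸k]!∣n!; [n-k]*[n-k-1]!≡[n-k]!;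
         nCk+nC[k+1]≡[n+1]C[k+1])
open import Data.Nat.DivMod using (m/n*n≡m)
open import Data.Nat.Primality using (euclidsLemma; ¬prime[0]; ¬prime[1])
open import Data.Nat.LCM using (m∣lcm[m,n]; n∣lcm[m,n])
open import Data.List.Properties using (++-assoc)
open import Data.Integer.DivMod using (_%ℕ_; _/ℕ_; a≡a%ℕn+[a/ℕn]*n; n%ℕd<d)
open import Relation.Binary.Definitions using (tri<; tri≈; tri>)
import Data.Nat.Properties as ℕP
import Data.Nat.Divisibility as ℕD
open import Data.Integer using (+_; _+_; _-_; -_; _*_; _^_; 0ℤ; 1ℤ; -1ℤ)
import Data.Integer.Properties as ℤP
import Data.Integer.Divisibility.Signed as ℤS
open import Data.Integer.Tactic.RingSolver using (solve-∀)
open import Data.Product using (Σ; _,_; proj₁; proj₂)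
open import Data.Sum using (inj₁; inj₂)
open import Data.Empty using (⊥-elim)
open import Relation.Nullary using (¬_; yes; no)
open import Relation.Binary.PropositionalEquality
  using (refl; sym; trans; cong; cong₂; subst; subst₂; _≢_; module ≡-Reasoning)
open import Relation.Binary.Bundles using (Setoid)
import Relation.Binary.Reasoning.Setoid as SetoidReasoning
open import Data.Rational using (mkℚ)
open import Data.Rational.Unnormalised as ℚᵘ using (ℚᵘ; mkℚᵘ; _≃_; *≡*)
import Data.Rational.Unnormalised.Properties as ℚᵘP
import Data.Rational.Properties as ℚP
open import Data.Nat.Coprimality as Coprime using (coprime-divisor)

-- Finite sums and the binomial theorem

sumTo-cong : ∀ m {f g : ℕ → ℤ} → (∀ x → f x ≡ g x) → sumTo m f ≡ sumTo m g
sumTo-cong zero    f≡g = refl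
sumTo-cong (suc m) f≡g = cong₂ _+_ (sumTo-cong m f≡g) (f≡g m)

sumTo-zero : ∀ m → sumTo m (λ _ → 0ℤ) ≡ 0ℤ
sumTo-zero zero    = refl
sumTo-zero (suc m) = trans (ℤP.+-identityʳ _) (sumTo-zero m)

sumTo-const : ∀ m c → sumTo m (λ _ → c) ≡ + m * c
sumTo-const zero    c = refl
sumTo-const (suc m) c = trans (cong (_+ c) (sumTo-const m c)) (step (+ m) c)
  where step : ∀ m c → m * c + c ≡ (1ℤ + m) * c
        step = solve-∀

sumTo-+ : ∀ m (f g : ℕ → ℤ) → sumTo m (λ x → f x + g x) ≡ sumTo m f + sumTo m g
sumTo-+ zero    f g = refl
sumTo-+ (suc m) f g =
  trans (cong (_+ (f m + g m)) (sumTo-+ m f g)) (regroup (sumTo m f) (sumTo m g) (f m) (g m))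
  where regroup : ∀ a b c d → a + b + (c + d) ≡ a + c + (b + d)
        regroup = solve-∀

sumTo-*ˡ : ∀ m c (f : ℕ → ℤ) → sumTo m (λ x → c * f x) ≡ c * sumTo m f
sumTo-*ˡ zero    c f = sym (ℤP.*-zeroʳ c)
sumTo-*ˡ (suc m) c f =
  trans (cong (_+ c * f m) (sumTo-*ˡ m c f)) (sym (ℤP.*-distribˡ-+ c (sumTo m f) (f m)))

sumTo-shift : ∀ m (f : ℕ → ℤ) → sumTo (suc m) f ≡ f 0 + sumTo m (λ x → f (suc x))
sumTo-shift zero    f = trans (ℤP.+-identityˡ (f 0)) (sym (ℤP.+-identityʳ (f 0)))
sumTo-shift (suc m) f = trans (cong (_+ f (suc m)) (sumTo-shift m f)) (ℤP.+-assoc (f 0) _ _)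

sumTo-comm : ∀ m n (h : ℕ → ℕ → ℤ) →
  sumTo m (λ x → sumTo n (h x)) ≡ sumTo n (λ k → sumTo m (λ x → h x k))
sumTo-comm zero    n h = sym (sumTo-zero n)
sumTo-comm (suc m) n h = trans (cong (_+ sumTo n (h m)) (sumTo-comm m n h))
  (sym (sumTo-+ n (λ k → sumTo m (λ x → h x k)) (h m)))

sumTo-telescope : ∀ m (h : ℕ → ℤ) → sumTo m (λ x → h (suc x) - h x) ≡ h m - h 0
sumTo-telescope zero    h = sym (ℤP.+-inverseʳ (h 0))
sumTo-telescope (suc m) h =
  trans (cong (_+ (h (suc m) - h m)) (sumTo-telescope m h)) (regroup (h m) (h 0) (h (suc m)))
  where regroup : ∀ a b c → a - b + (c - a) ≡ c - b
        regroup = solve-∀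

binomial-theorem : ∀ n y → (1ℤ + y) ^ n ≡ sumTo (suc n) (λ k → + (n C k) * y ^ k)
binomial-theorem zero    y = refl
binomial-theorem (suc n) y = sym (begin
  sumTo (suc (suc n)) (λ k → + (suc n C k) * y ^ k)
    ≡⟨ sumTo-shift (suc n) _ ⟩
  1ℤ * 1ℤ + sumTo (suc n) (λ k → + (suc n C suc k) * (y * y ^ k))
    ≡⟨ cong (_+_ (1ℤ * 1ℤ)) (sumTo-cong (suc n) pascal) ⟩
  1ℤ * 1ℤ + sumTo (suc n) (λ k → y * (+ (n C k) * y ^ k) + + (n C suc k) * y ^ suc k)
    ≡⟨ cong (_+_ (1ℤ * 1ℤ)) (sumTo-+ (suc n) _ _) ⟩
  1ℤ * 1ℤ + (sumTo (suc n) (λ k → y * (+ (n C k) * y ^ k)) + (U + + (n C suc n) * y ^ suc n))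
    ≡⟨ cong (λ t → 1ℤ * 1ℤ + (t + (U + + (n C suc n) * y ^ suc n))) (sumTo-*ˡ (suc n) y _) ⟩
  1ℤ * 1ℤ + (y * T + (U + + (n C suc n) * y ^ suc n))
    ≡⟨ cong (λ c → 1ℤ * 1ℤ + (y * T + (U + + c * y ^ suc n))) (k>n⇒nCk≡0 (ℕP.n<1+n n)) ⟩
  1ℤ * 1ℤ + (y * T + (U + 0ℤ * y ^ suc n))
    ≡⟨ cong (λ t → 1ℤ * 1ℤ + (y * t + (U + 0ℤ * y ^ suc n))) T≡1+U ⟩
  1ℤ * 1ℤ + (y * (1ℤ * 1ℤ + U) + (U + 0ℤ * y ^ suc n))
    ≡⟨ collect y U (y ^ suc n) ⟩
  (1ℤ + y) * (1ℤ * 1ℤ + U)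
    ≡⟨ cong ((1ℤ + y) *_) (sym T≡1+U) ⟩
  (1ℤ + y) * T
    ≡⟨ cong ((1ℤ + y) *_) (sym (binomial-theorem n y)) ⟩
  (1ℤ + y) ^ suc n ∎)
  where
    open ≡-Reasoning
    T = sumTo (suc n) (λ k → + (n C k) * y ^ k)
    U = sumTo n (λ k → + (n C suc k) * y ^ suc k)
    T≡1+U : T ≡ 1ℤ * 1ℤ + U
    T≡1+U = sumTo-shift n _
    distrib : ∀ a b y z → (a + b) * (y * z) ≡ y * (a * z) + b * (y * z)
    distrib = solve-∀
    pascal : ∀ k → + (suc n C suc k) * (y * y ^ k) ≡ y * (+ (n C k) * y ^ k) + + (n C suc k) * y ^ suc k
    pascal k = trans (cong (λ c → + c * (y * y ^ k)) (sym (nCk+nC[k+1]≡[n+1]C[k+1] n k)))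
      (trans (cong (_* (y * y ^ k)) (ℤP.pos-+ (n C k) (n C suc k)))
             (distrib (+ (n C k)) (+ (n C suc k)) y (y ^ k)))
    collect : ∀ y U w → 1ℤ * 1ℤ + (y * (1ℤ * 1ℤ + U) + (U + 0ℤ * w)) ≡ (1ℤ + y) * (1ℤ * 1ℤ + U)
    collect = solve-∀

pos-∸ : ∀ {n k} → k ℕ.≤ n → + n - + k ≡ + (n ∸ k)
pos-∸ {n} {k} k≤n = trans (ℤP.m-n≡m⊖n n k) (ℤP.⊖-≥ k≤n)

pos-^ : ∀ d n → + (d ℕ.^ n) ≡ (+ d) ^ n
pos-^ d zero    = refl
pos-^ d (suc n) = trans (ℤP.pos-* d (d ℕ.^ n)) (cong (+ d *_) (pos-^ d n))

-1^k*-1^k≡1 : ∀ k → -1ℤ ^ k * -1ℤ ^ k ≡ 1ℤ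
-1^k*-1^k≡1 zero    = refl
-1^k*-1^k≡1 (suc k) = trans (regroup (-1ℤ ^ k)) (-1^k*-1^k≡1 k)
  where regroup : ∀ s → -1ℤ * s * (-1ℤ * s) ≡ s * s
        regroup = solve-∀

neg-^ : ∀ x k → (- x) ^ k ≡ -1ℤ ^ k * x ^ k
neg-^ x zero    = refl
neg-^ x (suc k) = trans (cong (- x *_) (neg-^ x k)) (regroup x (-1ℤ ^ k) (x ^ k))
  where regroup : ∀ x s y → - x * (s * y) ≡ -1ℤ * s * (x * y)
        regroup = solve-∀

beta-integrand-expansion : ∀ A B x →
  x ^ A * (1ℤ - x) ^ B ≡ sumTo (suc B) (λ k → + (B C k) * -1ℤ ^ k * x ^ (A ℕ.+ k))
beta-integrand-expansion A B x = begin
  x ^ A * (1ℤ - x) ^ B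
    ≡⟨ cong (x ^ A *_) (binomial-theorem B (- x)) ⟩
  x ^ A * sumTo (suc B) (λ k → + (B C k) * (- x) ^ k)
    ≡⟨ sym (sumTo-*ˡ (suc B) (x ^ A) _) ⟩
  sumTo (suc B) (λ k → x ^ A * (+ (B C k) * (- x) ^ k))
    ≡⟨ sumTo-cong (suc B) term ⟩
  sumTo (suc B) (λ k → + (B C k) * -1ℤ ^ k * x ^ (A ℕ.+ k)) ∎
  where
    open ≡-Reasoning
    regroup : ∀ X c s Y → X * (c * (s * Y)) ≡ c * s * (X * Y)
    regroup = solve-∀
    term : ∀ k → x ^ A * (+ (B C k) * (- x) ^ k) ≡ + (B C k) * -1ℤ ^ k * x ^ (A ℕ.+ k)
    term k = trans (cong (λ y → x ^ A * (+ (B C k) * y)) (neg-^ x k))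
      (trans (regroup (x ^ A) (+ (B C k)) (-1ℤ ^ k) (x ^ k))
             (cong (+ (B C k) * -1ℤ ^ k *_) (sym (ℤP.^-distribˡ-+-* x A k))))

rising : ℤ → ℕ → ℤ
rising x zero    = 1ℤ
rising x (suc k) = rising x k * (x + + k)

falling : ℤ → ℕ → ℤ
falling x zero    = 1ℤ
falling x (suc k) = falling x k * (x - + k)

rising-factorial : ∀ c a → rising (+ suc c) a * + (c !) ≡ + ((c ℕ.+ a) !)
rising-factorial c zero = trans (ℤP.*-identityˡ _) (cong (λ m → + (m !)) (sym (ℕP.+-identityʳ c)))
rising-factorial c (suc a) = begin
  rising (+ suc c) a * (+ suc c + + a) * + (c !)
    ≡⟨ regroup (rising (+ suc c) a) (+ suc c + + a) (+ (c !)) ⟩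
  rising (+ suc c) a * + (c !) * (+ suc c + + a)
    ≡⟨ cong₂ _*_ (rising-factorial c a) (sym (ℤP.pos-+ (suc c) a)) ⟩
  + ((c ℕ.+ a) !) * + suc (c ℕ.+ a)
    ≡⟨ trans (ℤP.*-comm (+ ((c ℕ.+ a) !)) _) (sym (ℤP.pos-* (suc (c ℕ.+ a)) _)) ⟩
  + (suc (c ℕ.+ a) !)
    ≡⟨ cong (λ m → + (m !)) (sym (ℕP.+-suc c a)) ⟩
  + ((c ℕ.+ suc a) !) ∎
  where
    open ≡-Reasoning
    regroup : ∀ r s f → r * s * f ≡ r * f * s
    regroup = solve-∀

falling-neg : ∀ x k → falling (- x) k ≡ -1ℤ ^ k * rising x k
falling-neg x zero    = refl
falling-neg x (suc k) =
  trans (cong (_* (- x - + k)) (falling-neg x k)) (regroup x (+ k) (-1ℤ ^ k) (rising x k))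
  where regroup : ∀ x k s r → s * r * (- x - k) ≡ -1ℤ * s * (r * (x + k))
        regroup = solve-∀

falling-factorial : ∀ n k → k ℕ.≤ n → falling (+ n) k * + ((n ∸ k) !) ≡ + (n !)
falling-factorial n zero    _     = ℤP.*-identityˡ _
falling-factorial n (suc k) k<n = begin
  falling (+ n) k * (+ n - + k) * + ((n ∸ suc k) !)
    ≡⟨ ℤP.*-assoc (falling (+ n) k) _ _ ⟩
  falling (+ n) k * ((+ n - + k) * + ((n ∸ suc k) !))
    ≡⟨ cong (λ d → falling (+ n) k * (d * + ((n ∸ suc k) !))) (pos-∸ (ℕP.<⇒≤ k<n)) ⟩
  falling (+ n) k * (+ (n ∸ k) * + ((n ∸ suc k) !))
    ≡⟨ cong (falling (+ n) k *_) (sym (ℤP.pos-* (n ∸ k) _)) ⟩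
  falling (+ n) k * + ((n ∸ k) ℕ.* (n ∸ suc k) !)
    ≡⟨ cong (λ m → falling (+ n) k * + m) ([n-k]*[n-k-1]!≡[n-k]! k<n) ⟩
  falling (+ n) k * + ((n ∸ k) !)
    ≡⟨ falling-factorial n k (ℕP.<⇒≤ k<n) ⟩
  + (n !) ∎
  where open ≡-Reasoning

falling-vanish : ∀ n k → n ℕ.< k → falling (+ n) k ≡ 0ℤ
falling-vanish n (suc k) n<1+k with n ℕ.≟ k
... | yes refl = trans (cong (falling (+ n) k *_) (ℤP.+-inverseʳ (+ n))) (ℤP.*-zeroʳ (falling (+ n) k))
... | no n≢k   = trans (cong (_* (+ n - + k)) (falling-vanish n k (ℕP.≤∧≢⇒< (ℕP.≤-pred n<1+k) n≢k)))
                       (ℤP.*-zeroˡ (+ n - + k))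

C-factorial : ∀ {n k} → k ℕ.≤ n → (n C k) ℕ.* (k ! ℕ.* (n ∸ k) !) ≡ n !
C-factorial {n} {k} k≤n =
  trans (cong (ℕ._* (k ! ℕ.* (n ∸ k) !)) (nCk≡n!/k![n-k]! k≤n)) (m/n*n≡m (k![n∸k]!∣n! k≤n))
  where instance _ = k ℕP.!* (n ∸ k) !≢0

C*!≡falling : ∀ n k → + (n C k) * + (k !) ≡ falling (+ n) k
C*!≡falling n k with k ℕ.≤? n
... | yes k≤n = ℤP.*-cancelʳ-≡ _ _ (+ ((n ∸ k) !)) (begin
  + (n C k) * + (k !) * + ((n ∸ k) !)      ≡⟨ ℤP.*-assoc (+ (n C k)) _ _ ⟩
  + (n C k) * (+ (k !) * + ((n ∸ k) !))    ≡⟨ cong (+ (n C k) *_) (sym (ℤP.pos-* (k !) _)) ⟩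
  + (n C k) * + (k ! ℕ.* (n ∸ k) !)        ≡⟨ sym (ℤP.pos-* (n C k) _) ⟩
  + ((n C k) ℕ.* (k ! ℕ.* (n ∸ k) !))        ≡⟨ cong +_ (C-factorial k≤n) ⟩
  + (n !)                                  ≡⟨ sym (falling-factorial n k k≤n) ⟩
  falling (+ n) k * + ((n ∸ k) !)          ∎)
  where
    open ≡-Reasoning
    instance _ = (n ∸ k) ℕP.!≢0
... | no k≰n = begin
  + (n C k) * + (k !)  ≡⟨ cong (λ c → + c * + (k !)) (k>n⇒nCk≡0 (ℕP.≰⇒> k≰n)) ⟩
  0ℤ                   ≡⟨ sym (falling-vanish n k (ℕP.≰⇒> k≰n)) ⟩
  falling (+ n) k      ∎
  where open ≡-Reasoning

prime∤! : ∀ {q m} → Prime q → m ℕ.< q → ¬ (q ∣ m !)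
prime∤! {q} {zero}  q-prime _   q∣1 = ¬prime[1] (subst Prime (ℕD.∣1⇒≡1 q∣1) q-prime)
prime∤! {q} {suc m} q-prime m<q q∣[1+m]! with euclidsLemma (suc m) (m !) q-prime q∣[1+m]!
... | inj₁ q∣1+m = ℕD.>⇒∤ m<q q∣1+m
... | inj₂ q∣m!  = prime∤! q-prime (ℕP.<-trans (ℕP.n<1+n m) m<q) q∣m!

prime∣C : ∀ {q k} → Prime q → 0 ℕ.< k → k ℕ.< q → q ∣ q C k
prime∣C {suc q} {k} q-prime 0<k k<q
  with euclidsLemma (suc q C k) (k ! ℕ.* (suc q ∸ k) !) q-prime
         (subst (suc q ∣_) (sym (C-factorial (ℕP.<⇒≤ k<q))) (ℕD.m∣m*n (q !)))
... | inj₁ q∣C = q∣C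
... | inj₂ q∣factorials with euclidsLemma (k !) ((suc q ∸ k) !) q-prime q∣factorials
...   | inj₁ q∣k!     = ⊥-elim (prime∤! q-prime k<q q∣k!)
...   | inj₂ q∣[q-k]! = ⊥-elim (prime∤! q-prime (ℕP.∸-monoʳ-< 0<k (ℕP.<⇒≤ k<q)) q∣[q-k]!)

-- Polynomial functions of degree < n; poly-ext makes up for the lack of function extensionality.

data Poly< : ℕ → (ℤ → ℤ) → Set where
  poly-zero     : ∀ {n} → Poly< n (λ _ → 0ℤ)
  poly-monomial : ∀ {n i} → i ℕ.< n → Poly< n (λ x → x ^ i)
  poly-+        : ∀ {n f g} → Poly< n f → Poly< n g → Poly< n (λ x → f x + g x)
  poly-scale    : ∀ {n f} c → Poly< n f → Poly< n (λ x → c * f x)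
  poly-ext      : ∀ {n f g} → (∀ x → f x ≡ g x) → Poly< n f → Poly< n g

Poly<-suc : ∀ {n f} → Poly< n f → Poly< (suc n) f
Poly<-suc poly-zero            = poly-zero
Poly<-suc (poly-monomial i<n)  = poly-monomial (ℕP.m<n⇒m<1+n i<n)
Poly<-suc (poly-+ f g)         = poly-+ (Poly<-suc f) (Poly<-suc g)
Poly<-suc (poly-scale c f)     = poly-scale c (Poly<-suc f)
Poly<-suc (poly-ext f≡g f)     = poly-ext f≡g (Poly<-suc f)

Poly<-x* : ∀ {n f} → Poly< n f → Poly< (suc n) (λ x → x * f x)
Poly<-x* poly-zero           = poly-ext (λ x → sym (ℤP.*-zeroʳ x)) poly-zero
Poly<-x* (poly-monomial i<n) = poly-monomial (s≤s i<n)
Poly<-x* (poly-+ {f = f} {g} pf pg) =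
  poly-ext (λ x → sym (ℤP.*-distribˡ-+ x (f x) (g x))) (poly-+ (Poly<-x* pf) (Poly<-x* pg))
Poly<-x* (poly-scale {f = f} c pf) = poly-ext (λ x → swap x c (f x)) (poly-scale c (Poly<-x* pf))
  where swap : ∀ x c y → c * (x * y) ≡ x * (c * y)
        swap = solve-∀
Poly<-x* (poly-ext f≡g pf)   = poly-ext (λ x → cong (x *_) (f≡g x)) (Poly<-x* pf)

suc-pow-expansion : ∀ k → Σ (ℤ → ℤ) λ g → Poly< k g ×
  (∀ x → (1ℤ + x) ^ suc k ≡ x ^ suc k + + suc k * x ^ k + g x)
suc-pow-expansion zero = (λ _ → 0ℤ) , poly-zero , expand
  where expand : ∀ x → (1ℤ + x) * 1ℤ ≡ x * 1ℤ + 1ℤ * 1ℤ + 0ℤ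
        expand = solve-∀
suc-pow-expansion (suc k) with suc-pow-expansion k
... | g , g<k , expansion =
  (λ x → x * g x + (+ suc k * x ^ k + g x)) ,
  poly-+ (Poly<-x* g<k) (poly-+ (poly-scale (+ suc k) (poly-monomial ℕP.≤-refl)) (Poly<-suc g<k)) ,
  λ x → trans (cong ((1ℤ + x) *_) (expansion x)) (expand x (x ^ k) (g x) (+ suc k))
  where expand : ∀ x X G K → (1ℤ + x) * (x * X + K * X + G)
                   ≡ x * (x * X) + (1ℤ + K) * (x * X) + (x * G + (K * X + G))
        expand = solve-∀

falling-monic : ∀ k → Σ (ℤ → ℤ) λ g → Poly< k g × (∀ x → falling x k ≡ x ^ k + g x)
falling-monic zero = (λ _ → 0ℤ) , poly-zero , (λ x → refl)
falling-monic (suc k) with falling-monic k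
... | g , g<k , expansion =
  (λ x → - + k * x ^ k + (x * g x + - + k * g x)) ,
  poly-+ (poly-scale (- + k) (poly-monomial ℕP.≤-refl))
         (poly-+ (Poly<-x* g<k) (Poly<-suc (poly-scale (- + k) g<k))) ,
  λ x → trans (cong (_* (x - + k)) (expansion x)) (expand x (x ^ k) (g x) (+ k))
  where expand : ∀ x X G K → (X + G) * (x - K) ≡ x * X + (- K * X + (x * G + - K * G))
        expand = solve-∀

module Congruence (n : ℕ) where

  infix 4 _≋_ _≉_
  -- A record rather than a synonym for + n ∣ a - b, so that a and b can be inferred.
  record _≋_ (a b : ℤ) : Set where
    constructor mk≋
    field divides : + n ℤS.∣ a - b

  _≉_ : ℤ → ℤ → Set
  a ≉ b = ¬ a ≋ b

  ≋⇒≡[mod] : ∀ {a b} → a ≋ b → a ≡ b [mod n ]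
  ≋⇒≡[mod] (mk≋ d) = ℤS.∣⇒∣ᵤ d

  ≋-by : ∀ {a b} k → a - b ≡ k * + n → a ≋ b
  ≋-by k eq = mk≋ (ℤS.divides k eq)

  ≡⇒≋ : ∀ {a b} → a ≡ b → a ≋ b
  ≡⇒≋ {a} refl = ≋-by 0ℤ (trans (ℤP.+-inverseʳ a) (sym (ℤP.*-zeroˡ (+ n))))

  ≋-refl : ∀ {a} → a ≋ a
  ≋-refl = ≡⇒≋ refl

  ≋-sym : ∀ {a b} → a ≋ b → b ≋ a
  ≋-sym {a} {b} (mk≋ d) = mk≋ (subst (+ n ℤS.∣_) (flip a b) (ℤS.∣m⇒∣-m d))
    where flip : ∀ a b → - (a - b) ≡ b - a
          flip = solve-∀

  ≋-trans : ∀ {a b c} → a ≋ b → b ≋ c → a ≋ c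
  ≋-trans {a} {b} {c} (mk≋ d) (mk≋ e) =
    mk≋ (subst (+ n ℤS.∣_) (ℤP.+-minus-telescope a b c) (ℤS.∣m∣n⇒∣m+n d e))

  ≋-setoid : Setoid _ _
  ≋-setoid = record
    { Carrier = ℤ ; _≈_ = _≋_
    ; isEquivalence = record { refl = ≋-refl ; sym = ≋-sym ; trans = ≋-trans } }

  +-cong : ∀ {a b c d} → a ≋ b → c ≋ d → a + c ≋ b + d
  +-cong {a} {b} {c} {d} (mk≋ e) (mk≋ f) =
    mk≋ (subst (+ n ℤS.∣_) (regroup a b c d) (ℤS.∣m∣n⇒∣m+n e f))
    where regroup : ∀ a b c d → (a - b) + (c - d) ≡ (a + c) - (b + d)
          regroup = solve-∀

  +-congˡ : ∀ a {c d} → c ≋ d → a + c ≋ a + d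
  +-congˡ a = +-cong (≋-refl {a})

  +-congʳ : ∀ c {a b} → a ≋ b → a + c ≋ b + c
  +-congʳ c e = +-cong e (≋-refl {c})

  neg-cong : ∀ {a b} → a ≋ b → - a ≋ - b
  neg-cong {a} {b} (mk≋ e) = mk≋ (subst (+ n ℤS.∣_) (regroup a b) (ℤS.∣m⇒∣-m e))
    where regroup : ∀ a b → - (a - b) ≡ - a - - b
          regroup = solve-∀

  -‿cong : ∀ {a b c d} → a ≋ b → c ≋ d → a - c ≋ b - d
  -‿cong e f = +-cong e (neg-cong f)

  *-cong : ∀ {a b c d} → a ≋ b → c ≋ d → a * c ≋ b * d
  *-cong {a} {b} {c} {d} (mk≋ e) (mk≋ f) =
    mk≋ (subst (+ n ℤS.∣_) (regroup a b c d) (ℤS.∣m∣n⇒∣m+n (ℤS.∣m⇒∣m*n c e) (ℤS.∣n⇒∣m*n b f)))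
    where regroup : ∀ a b c d → (a - b) * c + b * (c - d) ≡ a * c - b * d
          regroup = solve-∀

  *-congˡ : ∀ c {a b} → a ≋ b → c * a ≋ c * b
  *-congˡ c = *-cong (≋-refl {c})

  *-congʳ : ∀ c {a b} → a ≋ b → a * c ≋ b * c
  *-congʳ c e = *-cong e (≋-refl {c})

  ^-cong : ∀ {a b} k → a ≋ b → a ^ k ≋ b ^ k
  ^-cong zero    e = ≋-refl
  ^-cong (suc k) e = *-cong e (^-cong k e)

  n≋0 : + n ≋ 0ℤ
  n≋0 = ≋-by 1ℤ (trans (ℤP.+-identityʳ (+ n)) (sym (ℤP.*-identityˡ (+ n))))

  ≋0⇒∣ : ∀ {a} → a ≋ 0ℤ → n ∣ ℤ.∣ a ∣
  ≋0⇒∣ {a} (mk≋ d) = subst (λ z → n ∣ ℤ.∣ z ∣) (ℤP.+-identityʳ a) (ℤS.∣⇒∣ᵤ d)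

  ∣⇒≋0 : ∀ {a} → n ∣ ℤ.∣ a ∣ → a ≋ 0ℤ
  ∣⇒≋0 {a} d = mk≋ (ℤS.∣ᵤ⇒∣ (subst (λ z → n ∣ ℤ.∣ z ∣) (sym (ℤP.+-identityʳ a)) d))

  ≋⇒-≋0 : ∀ {a b} → a ≋ b → a - b ≋ 0ℤ
  ≋⇒-≋0 {a} {b} (mk≋ d) = mk≋ (subst (+ n ℤS.∣_) (sym (ℤP.+-identityʳ (a - b))) d)

  -≋0⇒≋ : ∀ {a b} → a - b ≋ 0ℤ → a ≋ b
  -≋0⇒≋ {a} {b} (mk≋ d) = mk≋ (subst (+ n ℤS.∣_) (ℤP.+-identityʳ (a - b)) d)

  sumTo-cong≋ : ∀ m {f g : ℕ → ℤ} → (∀ x → x ℕ.< m → f x ≋ g x) → sumTo m f ≋ sumTo m g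
  sumTo-cong≋ zero    f≋g = ≋-refl
  sumTo-cong≋ (suc m) f≋g =
    +-cong (sumTo-cong≋ m (λ x x<m → f≋g x (ℕP.m<n⇒m<1+n x<m))) (f≋g m ℕP.≤-refl)

  sumTo-≋0 : ∀ m {f : ℕ → ℤ} → (∀ x → x ℕ.< m → f x ≋ 0ℤ) → sumTo m f ≋ 0ℤ
  sumTo-≋0 m f≋0 = ≋-trans (sumTo-cong≋ m f≋0) (≡⇒≋ (sumTo-zero m))

  sumTo-single : ∀ m k {f : ℕ → ℤ} → k ℕ.< m →
    (∀ x → x ℕ.< m → x ≢ k → f x ≋ 0ℤ) → sumTo m f ≋ f k
  sumTo-single (suc m) k {f} k<1+m others with k ℕ.≟ m
  ... | yes refl = ≋-trans
        (+-congʳ (f k) (sumTo-≋0 m (λ x x<m → others x (ℕP.m<n⇒m<1+n x<m) (ℕP.<⇒≢ x<m))))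
        (≡⇒≋ (ℤP.+-identityˡ (f k)))
  ... | no k≢m = ≋-trans
        (+-cong (sumTo-single m k (ℕP.≤∧≢⇒< (ℕP.≤-pred k<1+m) k≢m)
                  (λ x x<m → others x (ℕP.m<n⇒m<1+n x<m)))
                (others m ℕP.≤-refl (λ m≡k → k≢m (sym m≡k))))
        (≡⇒≋ (ℤP.+-identityʳ (f k)))

-- Rationals as fractions with a common denominator

toℚᵘ-≃⇒denominator-∣ : ∀ (x : ℚ) (y : ℚᵘ) → ℚ.toℚᵘ x ≃ y → ℚ.denominatorℕ x ∣ ℚᵘ.denominatorℕ y
toℚᵘ-≃⇒denominator-∣ (mkℚ n d-1 coprime) (mkℚᵘ m e-1) (*≡* n*e≡m*d) =
  coprime-divisor (Coprime.sym (Coprime.recompute coprime)) (ℕD.divides ℤ.∣ m ∣ ∣n∣*e≡∣m∣*d)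
  where
    ∣n∣*e≡∣m∣*d : ℤ.∣ n ∣ ℕ.* suc e-1 ≡ ℤ.∣ m ∣ ℕ.* suc d-1
    ∣n∣*e≡∣m∣*d = trans (sym (ℤP.abs-* n (+ suc e-1))) (trans (cong ℤ.∣_∣ n*e≡m*d) (ℤP.abs-* m (+ suc d-1)))

numerator-integer : ∀ (z : ℚ) K → ℚ.toℚᵘ z ≃ mkℚᵘ K 0 → ℚ.numerator z ≡ K
numerator-integer z@(mkℚ n d-1 _) K z≃K@(*≡* n*1≡K*d) with ℕD.∣1⇒≡1 (toℚᵘ-≃⇒denominator-∣ z (mkℚᵘ K 0) z≃K)
... | refl = trans (sym (ℤP.*-identityʳ n)) (trans n*1≡K*d (ℤP.*-identityʳ K))

numerator-scaled : ∀ (x : ℚ) K m → ℚ.toℚᵘ x ≃ mkℚᵘ K m → ℚ.numerator ((+ suc m ℚ./ 1) ℚ.* x) ≡ K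
numerator-scaled x K m x≃K/m = numerator-integer ((+ suc m ℚ./ 1) ℚ.* x) K
  (ℚᵘP.≃-trans (ℚP.toℚᵘ-homo-* (+ suc m ℚ./ 1) x)
    (ℚᵘP.≃-trans (ℚᵘP.*-cong (ℚP.toℚᵘ-fromℚᵘ (mkℚᵘ (+ suc m) 0)) x≃K/m)
      (*≡* (trans (ℤP.*-identityʳ (+ suc m * K))
        (trans (ℤP.*-comm (+ suc m) K) (cong (λ d → K * + d) (sym (ℕP.*-identityˡ (suc m)))))))))

fraction-over : ∀ (x : ℚ) m → ℚ.denominatorℕ x ∣ suc m → Σ ℤ λ K → ℚ.toℚᵘ x ≃ mkℚᵘ K m
fraction-over (mkℚ n d-1 _) m (ℕD.divides t 1+m≡t*d) = n * + t ,
  *≡* (trans (cong (λ e → n * + e) 1+m≡t*d)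
      (trans (cong (n *_) (ℤP.pos-* t (suc d-1))) (sym (ℤP.*-assoc n (+ t) (+ suc d-1)))))

fraction-sub : ∀ K L m → mkℚᵘ K m ℚᵘ.- mkℚᵘ L m ≃ mkℚᵘ (K - L) m
fraction-sub K L m = *≡* (trans
  (cong (λ e → (K * + suc m + - L * + suc m) * + suc m) (sym (ℤP.pos-* (suc m) (suc m))))
  (trans (regroup K L (+ suc m)) (cong ((K - L) *_) (sym (ℤP.pos-* (suc m) (suc m))))))
  where regroup : ∀ K L d → (K * d + - L * d) * d ≡ (K - L) * (d * d)
        regroup = solve-∀

0ℚ≃0/m : ∀ m → ℚ.toℚᵘ 0ℚ ≃ mkℚᵘ 0ℤ m
0ℚ≃0/m m = *≡* refl

1ℚ≃m/m : ∀ m → ℚ.toℚᵘ 1ℚ ≃ mkℚᵘ (+ suc m) m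
1ℚ≃m/m m = *≡* (ℤP.*-comm 1ℤ (+ suc m))

<-over-fractions : ∀ {x y : ℚ} {K L m} → ℚ.toℚᵘ x ≃ mkℚᵘ K m → ℚ.toℚᵘ y ≃ mkℚᵘ L m →
  x ℚ.< y → K ℤ.< L
<-over-fractions {m = m} x≃ y≃ x<y
  with ℚᵘP.<-respˡ-≃ x≃ (ℚᵘP.<-respʳ-≃ y≃ (ℚP.toℚᵘ-mono-< x<y))
... | ℚᵘ.*<* K*d<L*d = ℤP.*-cancelʳ-<-nonNeg (+ suc m) K*d<L*d

≤-over-fractions : ∀ {x y : ℚ} {K L m} → ℚ.toℚᵘ x ≃ mkℚᵘ K m → ℚ.toℚᵘ y ≃ mkℚᵘ L m →
  x ℚ.≤ y → K ℤ.≤ L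
≤-over-fractions {K = K} {L} {m} x≃ y≃ x≤y
  with ℚᵘP.≤-respˡ-≃ x≃ (ℚᵘP.≤-respʳ-≃ y≃ (ℚP.toℚᵘ-mono-≤ x≤y))
... | ℚᵘ.*≤* K*d≤L*d = ℤP.*-cancelʳ-≤-pos K L (+ suc m) K*d≤L*d

-- p is written suc (suc p-2) so that the p ∸ 1 and p ∸ 2 of Defs compute.
module ModPrime (p-2 : ℕ) (p-prime : Prime (suc (suc p-2))) where

  p-1 p : ℕ
  p-1 = suc p-2
  p   = suc p-1

  open Congruence p public

  ≋0-euclid : ∀ a b → a * b ≋ 0ℤ → a ≋ 0ℤ ⊎ b ≋ 0ℤ
  ≋0-euclid a b ab≋0
    with euclidsLemma ℤ.∣ a ∣ ℤ.∣ b ∣ p-prime (subst (p ∣_) (ℤP.abs-* a b) (≋0⇒∣ ab≋0))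
  ... | inj₁ p∣a = inj₁ (∣⇒≋0 p∣a)
  ... | inj₂ p∣b = inj₂ (∣⇒≋0 p∣b)

  *-≉0 : ∀ {a b} → a ≉ 0ℤ → b ≉ 0ℤ → a * b ≉ 0ℤ
  *-≉0 {a} {b} a≉0 b≉0 ab≋0 with ≋0-euclid a b ab≋0
  ... | inj₁ a≋0 = a≉0 a≋0
  ... | inj₂ b≋0 = b≉0 b≋0

  *-cancelˡ-≋ : ∀ {z x y} → z ≉ 0ℤ → z * x ≋ z * y → x ≋ y
  *-cancelˡ-≋ {z} {x} {y} z≉0 zx≋zy
    with ≋0-euclid z (x - y) (≋-trans (≡⇒≋ (distrib z x y)) (≋⇒-≋0 zx≋zy))
    where distrib : ∀ z x y → z * (x - y) ≡ z * x - z * y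
          distrib = solve-∀
  ... | inj₁ z≋0   = ⊥-elim (z≉0 z≋0)
  ... | inj₂ x-y≋0 = -≋0⇒≋ x-y≋0

  *-cancelʳ-≋ : ∀ {z x y} → z ≉ 0ℤ → x * z ≋ y * z → x ≋ y
  *-cancelʳ-≋ {z} {x} {y} z≉0 xz≋yz =
    *-cancelˡ-≋ z≉0 (≋-trans (≡⇒≋ (ℤP.*-comm z x)) (≋-trans xz≋yz (≡⇒≋ (ℤP.*-comm y z))))

  <-≉ : ∀ {r m} → r ℕ.< m → m ℕ.< p → + m ≉ + r
  <-≉ {r} {m} r<m m<p m≋r =
    ℕD.>⇒∤ {{ℕ.>-nonZero (ℕP.m<n⇒0<n∸m r<m)}} (ℕP.≤-<-trans (ℕP.m∸n≤m m r) m<p)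
      (subst (λ z → p ∣ ℤ.∣ z ∣) (pos-∸ (ℕP.<⇒≤ r<m)) (≋0⇒∣ (≋⇒-≋0 m≋r)))

  pos-≉0 : ∀ {m} → 0 ℕ.< m → m ℕ.< p → + m ≉ 0ℤ
  pos-≉0 = <-≉

  ^-≉0 : ∀ {x} k → x ≉ 0ℤ → x ^ k ≉ 0ℤ
  ^-≉0 zero    x≉0 = pos-≉0 (s≤s z≤n) (s≤s (s≤s z≤n))
  ^-≉0 (suc k) x≉0 = *-≉0 x≉0 (^-≉0 k x≉0)

  !-≉0 : ∀ m → m ℕ.< p → + (m !) ≉ 0ℤ
  !-≉0 m m<p m!≋0 = prime∤! p-prime m<p (≋0⇒∣ m!≋0)

  ≋-%ℕ : ∀ y → y ≋ + (y %ℕ p)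
  ≋-%ℕ y = ≋-by (y /ℕ p)
    (trans (cong (_- + (y %ℕ p)) (a≡a%ℕn+[a/ℕn]*n y p)) (cancel (+ (y %ℕ p)) ((y /ℕ p) * + p)))
    where cancel : ∀ r q → r + q - r ≡ q
          cancel = solve-∀

  residue-unique : ∀ {r m} → r ℕ.< p → m ℕ.< p → + r ≋ + m → r ≡ m
  residue-unique {r} {m} r<p m<p r≋m with ℕP.<-cmp r m
  ... | tri< r<m _ _ = ⊥-elim (<-≉ r<m m<p (≋-sym r≋m))
  ... | tri≈ _ r≡m _ = r≡m
  ... | tri> _ _ m<r = ⊥-elim (<-≉ m<r r<p r≋m)

  %ℕ-residue : ∀ {y m} → y ≋ + m → m ℕ.< p → y %ℕ p ≡ m
  %ℕ-residue {y} y≋m m<p = residue-unique (n%ℕd<d y p) m<p (≋-trans (≋-sym (≋-%ℕ y)) y≋m)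

  pCk≋0 : ∀ {k} → 0 ℕ.< k → k ℕ.< p → + (p C k) ≋ 0ℤ
  pCk≋0 0<k k<p = ∣⇒≋0 (prime∣C p-prime 0<k k<p)

  fermat-ℕ : ∀ x → (+ x) ^ p ≋ + x
  fermat-ℕ zero    = ≋-refl
  fermat-ℕ (suc x) = begin
    (1ℤ + + x) ^ p
      ≡⟨ binomial-theorem p (+ x) ⟩
    sumTo p t + t p
      ≡⟨ cong (_+ t p) (sumTo-shift p-1 t) ⟩
    t 0 + sumTo p-1 (λ k → t (suc k)) + t p
      ≈⟨ +-congʳ (t p) (+-congˡ (t 0) (sumTo-≋0 p-1 (λ k k<p-1 →
           ≋-trans (*-congʳ ((+ x) ^ suc k) (pCk≋0 (s≤s z≤n) (s≤s k<p-1)))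
                   (≡⇒≋ (ℤP.*-zeroˡ ((+ x) ^ suc k)))))) ⟩
    t 0 + 0ℤ + + (p C p) * (+ x) ^ p
      ≡⟨ cong (λ c → t 0 + 0ℤ + + c * (+ x) ^ p) (nCn≡1 p) ⟩
    t 0 + 0ℤ + 1ℤ * (+ x) ^ p
      ≈⟨ +-congˡ (t 0 + 0ℤ) (*-congˡ 1ℤ (fermat-ℕ x)) ⟩
    t 0 + 0ℤ + 1ℤ * + x
      ≡⟨ simplify (+ x) ⟩
    1ℤ + + x ∎
    where
      open SetoidReasoning ≋-setoid
      t : ℕ → ℤ
      t k = + (p C k) * (+ x) ^ k
      simplify : ∀ y → 1ℤ * 1ℤ + 0ℤ + 1ℤ * y ≡ 1ℤ + y
      simplify = solve-∀

  fermat : ∀ x → x ^ p ≋ x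
  fermat x = ≋-trans (^-cong p (≋-%ℕ x)) (≋-trans (fermat-ℕ (x %ℕ p)) (≋-sym (≋-%ℕ x)))

  fermat-≉0 : ∀ {x} → x ≉ 0ℤ → x ^ p-1 ≋ 1ℤ
  fermat-≉0 {x} x≉0 = *-cancelˡ-≋ x≉0 (≋-trans (fermat x) (≡⇒≋ (sym (ℤP.*-identityʳ x))))

  -- Power sums

  powerSum : ℕ → ℤ
  powerSum j = sumTo p (λ x → (+ x) ^ j)

  sumTo-Poly<≋0 : ∀ {n f} → (∀ i → i ℕ.< n → powerSum i ≋ 0ℤ) → Poly< n f →
    sumTo p (λ x → f (+ x)) ≋ 0ℤ
  sumTo-Poly<≋0 vanish poly-zero           = ≡⇒≋ (sumTo-zero p)
  sumTo-Poly<≋0 vanish (poly-monomial i<n) = vanish _ i<n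
  sumTo-Poly<≋0 vanish (poly-+ {f = f} {g} pf pg) =
    ≋-trans (≡⇒≋ (sumTo-+ p (λ x → f (+ x)) (λ x → g (+ x))))
            (+-cong (sumTo-Poly<≋0 vanish pf) (sumTo-Poly<≋0 vanish pg))
  sumTo-Poly<≋0 vanish (poly-scale {f = f} c pf) =
    ≋-trans (≡⇒≋ (sumTo-*ˡ p c (λ x → f (+ x))))
            (≋-trans (*-congˡ c (sumTo-Poly<≋0 vanish pf)) (≡⇒≋ (ℤP.*-zeroʳ c)))
  sumTo-Poly<≋0 vanish (poly-ext f≡g pf) =
    ≋-trans (≡⇒≋ (sumTo-cong p (λ x → sym (f≡g (+ x))))) (sumTo-Poly<≋0 vanish pf)

  -- Σ_x ((1 + x)^(n+1) - x^(n+1)) telescopes to p^(n+1) ≡ 0, and the summand is (n + 1) x^n + lower powers.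
  powerSums-vanish : ∀ n → n ℕ.≤ p-1 → ∀ i → i ℕ.< n → powerSum i ≋ 0ℤ
  powerSums-vanish (suc n) n<p-1 i i<1+n with i ℕ.≟ n
  ... | no i≢n   = powerSums-vanish n (ℕP.<⇒≤ n<p-1) i (ℕP.≤∧≢⇒< (ℕP.≤-pred i<1+n) i≢n)
  ... | yes refl = *-cancelˡ-≋ (pos-≉0 (s≤s z≤n) (s≤s n<p-1)) (begin
    + suc n * powerSum n
      ≡⟨ sym (sumTo-*ˡ p (+ suc n) _) ⟩
    sumTo p (λ x → + suc n * (+ x) ^ n)
      ≈⟨ ≋-sym (≋-trans (+-congˡ S lower≋0) (≡⇒≋ (ℤP.+-identityʳ S))) ⟩
    sumTo p (λ x → + suc n * (+ x) ^ n) + sumTo p (λ x → g (+ x))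
      ≡⟨ sym (sumTo-+ p _ _) ⟩
    sumTo p (λ x → + suc n * (+ x) ^ n + g (+ x))
      ≡⟨ sumTo-cong p (λ x → sym (difference (+ x))) ⟩
    sumTo p (λ x → h (suc x) - h x)
      ≡⟨ sumTo-telescope p h ⟩
    (+ p) ^ suc n - 0ℤ
      ≈⟨ -‿cong (*-congʳ ((+ p) ^ n) n≋0) (≋-refl {0ℤ}) ⟩
    0ℤ
      ≡⟨ sym (ℤP.*-zeroʳ (+ suc n)) ⟩
    + suc n * 0ℤ ∎)
    where
      open SetoidReasoning ≋-setoid
      h : ℕ → ℤ
      h x = (+ x) ^ suc n
      S = sumTo p (λ x → + suc n * (+ x) ^ n)
      g = proj₁ (suc-pow-expansion n)
      lower≋0 : sumTo p (λ x → g (+ x)) ≋ 0ℤ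
      lower≋0 = sumTo-Poly<≋0 (powerSums-vanish n (ℕP.<⇒≤ n<p-1)) (proj₁ (proj₂ (suc-pow-expansion n)))
      difference : ∀ x → (1ℤ + x) ^ suc n - x ^ suc n ≡ + suc n * x ^ n + g x
      difference x = trans (cong (_- x ^ suc n) (proj₂ (proj₂ (suc-pow-expansion n)) x))
                           (cancel (x ^ suc n) _ _)
        where cancel : ∀ a b c → a + b + c - a ≡ b + c
              cancel = solve-∀

  powerSum<p-1≋0 : ∀ {i} → i ℕ.< p-1 → powerSum i ≋ 0ℤ
  powerSum<p-1≋0 = powerSums-vanish p-1 ℕP.≤-refl _

  sumTo-Poly<p-1≋0 : ∀ {f} → Poly< p-1 f → sumTo p (λ x → f (+ x)) ≋ 0ℤ
  sumTo-Poly<p-1≋0 = sumTo-Poly<≋0 (λ _ → powerSum<p-1≋0)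

  powerSum-p-1≋-1 : powerSum p-1 ≋ -1ℤ
  powerSum-p-1≋-1 = begin
    powerSum p-1
      ≡⟨ sumTo-shift p-1 _ ⟩
    0ℤ + sumTo p-1 (λ x → (+ suc x) ^ p-1)
      ≈⟨ +-congˡ 0ℤ (sumTo-cong≋ p-1 (λ x x<p-1 → fermat-≉0 (pos-≉0 (s≤s z≤n) (s≤s x<p-1)))) ⟩
    0ℤ + sumTo p-1 (λ _ → 1ℤ)
      ≡⟨ cong (_+_ 0ℤ) (sumTo-const p-1 1ℤ) ⟩
    0ℤ + + p-1 * 1ℤ
      ≈⟨ ≋-by 1ℤ (p-1≋-1 (+ p-1)) ⟩
    -1ℤ ∎
    where
      open SetoidReasoning ≋-setoid
      p-1≋-1 : ∀ a → 0ℤ + a * 1ℤ - -1ℤ ≡ 1ℤ * (1ℤ + a)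
      p-1≋-1 = solve-∀

  powerSum-periodic : ∀ d → powerSum (p ℕ.+ d) ≋ powerSum (suc d)
  powerSum-periodic d = sumTo-cong≋ p (λ x _ →
    ≋-trans (≡⇒≋ (ℤP.^-distribˡ-+-* (+ x) p d)) (*-congʳ ((+ x) ^ d) (fermat (+ x))))

  powerSum≢p-1≋0 : ∀ {j} → j ℕ.≤ p-1 ℕ.+ p-2 → j ≢ p-1 → powerSum j ≋ 0ℤ
  powerSum≢p-1≋0 {j} j≤ j≢p-1 with j ℕ.<? p-1
  ... | yes j<p-1 = powerSum<p-1≋0 j<p-1
  ... | no  j≮p-1 = ≋-trans (≡⇒≋ (cong powerSum (sym p+d≡j)))
                            (≋-trans (powerSum-periodic d) (powerSum<p-1≋0 1+d<p-1))
    where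
      p≤j : p ℕ.≤ j
      p≤j = ℕP.≤∧≢⇒< (ℕP.≮⇒≥ j≮p-1) (λ p-1≡j → j≢p-1 (sym p-1≡j))
      d = j ∸ p
      p+d≡j : p ℕ.+ d ≡ j
      p+d≡j = ℕP.m+[n∸m]≡n p≤j
      1+d<p-1 : suc d ℕ.< p-1
      1+d<p-1 = s≤s (ℕP.+-cancelˡ-≤ p-1 (suc d) p-2
        (subst (ℕ._≤ p-1 ℕ.+ p-2) (trans (sym p+d≡j) (cong suc (sym (ℕP.+-suc p-2 d)))) j≤))

  -- Wilson's theorem and Γ_p

  falling-cong : ∀ {x y} k → x ≋ y → falling x k ≋ falling y k
  falling-cong zero    x≋y = ≋-refl
  falling-cong (suc k) x≋y = *-cong (falling-cong k x≋y) (-‿cong x≋y (≋-refl {+ k}))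

  -- Only x = p-1 contributes to Σ_x x (x - 1) ⋯ (x - p + 2).
  wilson : + (p-1 !) ≋ -1ℤ
  wilson = begin
    + (p-1 !)
      ≡⟨ sym (trans (cong (λ m → falling (+ p-1) p-1 * + (m !)) (sym (ℕP.n∸n≡0 p-1)))
                    (falling-factorial p-1 p-1 ℕP.≤-refl)) ⟩
    falling (+ p-1) p-1 * 1ℤ
      ≡⟨ ℤP.*-identityʳ _ ⟩
    falling (+ p-1) p-1
      ≈⟨ ≋-sym (sumTo-single p p-1 ℕP.≤-refl (λ x x<p x≢p-1 →
           ≡⇒≋ (falling-vanish x p-1 (ℕP.≤∧≢⇒< (ℕP.≤-pred x<p) x≢p-1)))) ⟩
    sumTo p (λ x → falling (+ x) p-1)
      ≡⟨ sumTo-cong p (λ x → proj₂ (proj₂ (falling-monic p-1)) (+ x)) ⟩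
    sumTo p (λ x → (+ x) ^ p-1 + g (+ x))
      ≡⟨ sumTo-+ p _ _ ⟩
    powerSum p-1 + sumTo p (λ x → g (+ x))
      ≈⟨ +-cong powerSum-p-1≋-1 (sumTo-Poly<p-1≋0 (proj₁ (proj₂ (falling-monic p-1)))) ⟩
    -1ℤ + 0ℤ ∎
    where
      open SetoidReasoning ≋-setoid
      g = proj₁ (falling-monic p-1)

  reflection : ∀ k → k ℕ.≤ p-1 → -1ℤ ^ k * (+ (k !) * + ((p-1 ∸ k) !)) ≋ -1ℤ
  reflection k k≤p-1 = begin
    -1ℤ ^ k * (+ (k !) * + ((p-1 ∸ k) !))
      ≡⟨ cong (λ f → -1ℤ ^ k * (f * + ((p-1 ∸ k) !))) (sym (rising-factorial 0 k)) ⟩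
    -1ℤ ^ k * (rising 1ℤ k * 1ℤ * + ((p-1 ∸ k) !))
      ≡⟨ regroup (-1ℤ ^ k) (rising 1ℤ k) _ ⟩
    -1ℤ ^ k * rising 1ℤ k * + ((p-1 ∸ k) !)
      ≡⟨ cong (_* + ((p-1 ∸ k) !)) (sym (falling-neg 1ℤ k)) ⟩
    falling -1ℤ k * + ((p-1 ∸ k) !)
      ≈⟨ *-congʳ (+ ((p-1 ∸ k) !)) (falling-cong k (≋-by -1ℤ (p-1≋-1 (+ p-1)))) ⟩
    falling (+ p-1) k * + ((p-1 ∸ k) !)
      ≡⟨ falling-factorial p-1 k k≤p-1 ⟩
    + (p-1 !)
      ≈⟨ wilson ⟩
    -1ℤ ∎
    where
      open SetoidReasoning ≋-setoid
      regroup : ∀ s r m → s * (r * 1ℤ * m) ≡ s * r * m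
      regroup = solve-∀
      p-1≋-1 : ∀ a → -1ℤ - a ≡ -1ℤ * (1ℤ + a)
      p-1≋-1 = solve-∀

  prodCoprime-! : ∀ m → m ℕ.< p → prodCoprime p m ≡ + (m !)
  prodCoprime-! zero    _   = refl
  prodCoprime-! (suc m) m<p with p ℕD.∣? suc m
  ... | yes p∣1+m = ⊥-elim (ℕD.>⇒∤ m<p p∣1+m)
  ... | no  _     = trans (cong (_* + suc m) (prodCoprime-! m (ℕP.<-trans (ℕP.n<1+n m) m<p)))
                          (trans (ℤP.*-comm (+ (m !)) (+ suc m)) (sym (ℤP.pos-* (suc m) (m !))))

  -- suc (p-1 ∸ k) = p - k is the representative of -k in {1, …, p} at which Γpmod evaluates Γ_p.
  Γpℕ-reflection : ∀ k → k ℕ.≤ p-1 → Γpℕ p (suc (p-1 ∸ k)) * + (k !) ≋ 1ℤ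
  Γpℕ-reflection k k≤p-1 = begin
    -1ℤ ^ suc m * prodCoprime p m * + (k !)
      ≡⟨ cong (λ c → -1ℤ ^ suc m * c * + (k !)) (prodCoprime-! m (s≤s (ℕP.m∸n≤m p-1 k))) ⟩
    -1ℤ ^ suc m * + (m !) * + (k !)
      ≡⟨ sym (trans (cong (_*_ (-1ℤ ^ suc m * + (m !) * + (k !))) (-1^k*-1^k≡1 k)) (ℤP.*-identityʳ _)) ⟩
    -1ℤ ^ suc m * + (m !) * + (k !) * (-1ℤ ^ k * -1ℤ ^ k)
      ≡⟨ regroup (-1ℤ ^ suc m) (+ (m !)) (+ (k !)) (-1ℤ ^ k) ⟩
    -1ℤ ^ suc m * -1ℤ ^ k * (-1ℤ ^ k * (+ (k !) * + (m !)))
      ≡⟨ cong (_* (-1ℤ ^ k * (+ (k !) * + (m !)))) (sym (ℤP.^-distribˡ-+-* -1ℤ (suc m) k)) ⟩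
    -1ℤ ^ (suc m ℕ.+ k) * (-1ℤ ^ k * (+ (k !) * + (m !)))
      ≡⟨ cong (λ e → -1ℤ ^ suc e * (-1ℤ ^ k * (+ (k !) * + (m !)))) (ℕP.m∸n+n≡m k≤p-1) ⟩
    -1ℤ ^ p * (-1ℤ ^ k * (+ (k !) * + (m !)))
      ≈⟨ *-cong (fermat -1ℤ) (reflection k k≤p-1) ⟩
    -1ℤ * -1ℤ ∎
    where
      open SetoidReasoning ≋-setoid
      m = p-1 ∸ k
      regroup : ∀ a M K s → a * M * K * (s * s) ≡ a * s * (s * (K * M))
      regroup = solve-∀

  Γpmod-reflection : ∀ x k → k ℕ.≤ p-1 → redℚ p x ≋ - + k → Γpmod p x * + (k !) ≋ 1ℤ
  Γpmod-reflection x k k≤p-1 x≋-k =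
    subst (λ m → Γpℕ p (suc m) * + (k !) ≋ 1ℤ) (sym (%ℕ-residue x-1≋ (s≤s (ℕP.m∸n≤m p-1 k))))
          (Γpℕ-reflection k k≤p-1)
    where
      shift : ∀ k a → - k - 1ℤ - (a - k) ≡ -1ℤ * (1ℤ + a)
      shift = solve-∀
      x-1≋ : redℚ p x - 1ℤ ≋ + (p-1 ∸ k)
      x-1≋ = ≋-trans (-‿cong x≋-k (≋-refl {1ℤ}))
        (≋-by -1ℤ (trans (cong (λ m → - + k - 1ℤ - m) (sym (pos-∸ k≤p-1))) (shift (+ k) (+ p-1))))

  -- The Jacobi sum

  ω̄pow-≋ : ∀ k y → k ℕ.≤ p-2 → ω̄pow p (+ k) y ≋ y ^ (p-1 ∸ k)
  ω̄pow-≋ k y k≤p-2 with p ℕD.∣? ℤ.∣ y ∣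
  ... | yes p∣y = ≋-sym (begin
    y ^ (p-1 ∸ k)        ≡⟨ cong (y ^_) (ℕP.+-∸-assoc 1 k≤p-2) ⟩
    y * y ^ (p-2 ∸ k)    ≈⟨ *-congʳ (y ^ (p-2 ∸ k)) (∣⇒≋0 {y} p∣y) ⟩
    0ℤ * y ^ (p-2 ∸ k)   ≡⟨⟩
    0ℤ                   ∎)
    where open SetoidReasoning ≋-setoid
  ... | no p∤y = *-cancelʳ-≋ (^-≉0 k y≉0) (begin
    y ^ (p-2 ℕ.* k) * y ^ k      ≡⟨ sym (ℤP.^-distribˡ-+-* y (p-2 ℕ.* k) k) ⟩
    y ^ (p-2 ℕ.* k ℕ.+ k)        ≡⟨ cong (y ^_) (ℕP.+-comm (p-2 ℕ.* k) k) ⟩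
    y ^ (p-1 ℕ.* k)              ≡⟨ sym (ℤP.^-*-assoc y p-1 k) ⟩
    (y ^ p-1) ^ k                ≈⟨ ^-cong k (fermat-≉0 y≉0) ⟩
    1ℤ ^ k                       ≡⟨ ℤP.^-zeroˡ k ⟩
    1ℤ                           ≈⟨ ≋-sym (fermat-≉0 y≉0) ⟩
    y ^ p-1                      ≡⟨ cong (y ^_) (sym (ℕP.m∸n+n≡m (ℕP.m≤n⇒m≤1+n k≤p-2))) ⟩
    y ^ (p-1 ∸ k ℕ.+ k)          ≡⟨ ℤP.^-distribˡ-+-* y (p-1 ∸ k) k ⟩
    y ^ (p-1 ∸ k) * y ^ k        ∎)
    where
      open SetoidReasoning ≋-setoid
      y≉0 : y ≉ 0ℤ
      y≉0 y≋0 = p∤y (≋0⇒∣ y≋0)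

  -- Only the power sum of exponent A + a = p - 1 survives.
  beta-sum : ∀ a c → 1 ℕ.≤ c → a ℕ.+ c ℕ.≤ p-1 →
    sumTo p (λ x → (+ x) ^ (p-1 ∸ a) * (1ℤ - + x) ^ (p-1 ∸ c)) ≋ - (+ ((p-1 ∸ c) C a) * -1ℤ ^ a)
  beta-sum a c 1≤c a+c≤p-1 = begin
    sumTo p (λ x → (+ x) ^ A * (1ℤ - + x) ^ B)
      ≡⟨ sumTo-cong p (λ x → beta-integrand-expansion A B (+ x)) ⟩
    sumTo p (λ x → sumTo (suc B) (λ k → coef k * (+ x) ^ (A ℕ.+ k)))
      ≡⟨ sumTo-comm p (suc B) (λ x k → coef k * (+ x) ^ (A ℕ.+ k)) ⟩
    sumTo (suc B) (λ k → sumTo p (λ x → coef k * (+ x) ^ (A ℕ.+ k)))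
      ≡⟨ sumTo-cong (suc B) (λ k → sumTo-*ˡ p (coef k) (λ x → (+ x) ^ (A ℕ.+ k))) ⟩
    sumTo (suc B) (λ k → coef k * powerSum (A ℕ.+ k))
      ≈⟨ sumTo-single (suc B) a (s≤s a≤B) (λ k k≤B k≢a →
           ≋-trans (*-congˡ (coef k) (powerSum≢p-1≋0 (A+k≤ k k≤B) (λ A+k≡p-1 → k≢a (A+k≡p-1⇒k≡a k A+k≡p-1))))
                   (≡⇒≋ (ℤP.*-zeroʳ (coef k)))) ⟩
    coef a * powerSum (A ℕ.+ a)
      ≡⟨ cong (λ j → coef a * powerSum j) A+a≡p-1 ⟩
    coef a * powerSum p-1
      ≈⟨ *-congˡ (coef a) powerSum-p-1≋-1 ⟩
    coef a * -1ℤ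
      ≡⟨ trans (ℤP.*-comm (coef a) -1ℤ) (ℤP.-1*i≡-i (coef a)) ⟩
    - coef a ∎
    where
      open SetoidReasoning ≋-setoid
      A = p-1 ∸ a
      B = p-1 ∸ c
      coef : ℕ → ℤ
      coef k = + (B C k) * -1ℤ ^ k
      a≤p-1 : a ℕ.≤ p-1
      a≤p-1 = ℕP.m+n≤o⇒m≤o a a+c≤p-1
      a≤B : a ℕ.≤ B
      a≤B = ℕP.m+n≤o⇒m≤o∸n a a+c≤p-1
      A+a≡p-1 : A ℕ.+ a ≡ p-1
      A+a≡p-1 = ℕP.m∸n+n≡m a≤p-1
      A+k≡p-1⇒k≡a : ∀ k → A ℕ.+ k ≡ p-1 → k ≡ a
      A+k≡p-1⇒k≡a k A+k≡p-1 = ℕP.+-cancelˡ-≡ A k a (trans A+k≡p-1 (sym A+a≡p-1))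
      A+k≤ : ∀ k → k ℕ.< suc B → A ℕ.+ k ℕ.≤ p-1 ℕ.+ p-2
      A+k≤ k k≤B = ℕP.+-mono-≤ (ℕP.m∸n≤m p-1 a) (ℕP.≤-trans (ℕP.≤-pred k≤B) (ℕP.∸-monoʳ-≤ p-1 1≤c))

  C-reflection : ∀ a c → c ℕ.≤ p-1 →
    + ((p-1 ∸ c) C a) * -1ℤ ^ a * + (a !) * + (c !) ≋ + ((c ℕ.+ a) !)
  C-reflection a c c≤p-1 = begin
    + (B C a) * s * + (a !) * + (c !)
      ≡⟨ regroup (+ (B C a)) s (+ (a !)) (+ (c !)) ⟩
    s * (+ (B C a) * + (a !)) * + (c !)
      ≡⟨ cong (λ f → s * f * + (c !)) (C*!≡falling B a) ⟩
    s * falling (+ B) a * + (c !)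
      ≈⟨ *-congʳ (+ (c !)) (*-congˡ s (falling-cong a B≋-1-c)) ⟩
    s * falling (- + suc c) a * + (c !)
      ≡⟨ cong (λ f → s * f * + (c !)) (falling-neg (+ suc c) a) ⟩
    s * (s * rising (+ suc c) a) * + (c !)
      ≡⟨ regroup′ s (rising (+ suc c) a) (+ (c !)) ⟩
    s * s * (rising (+ suc c) a * + (c !))
      ≡⟨ cong₂ _*_ (-1^k*-1^k≡1 a) (rising-factorial c a) ⟩
    1ℤ * + ((c ℕ.+ a) !)
      ≡⟨ ℤP.*-identityˡ _ ⟩
    + ((c ℕ.+ a) !) ∎
    where
      open SetoidReasoning ≋-setoid
      B = p-1 ∸ c
      s = -1ℤ ^ a
      regroup : ∀ b s f g → b * s * f * g ≡ s * (b * f) * g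
      regroup = solve-∀
      regroup′ : ∀ s r g → s * (s * r) * g ≡ s * s * (r * g)
      regroup′ = solve-∀
      shift : ∀ a c → a - c - - (1ℤ + c) ≡ 1ℤ * (1ℤ + a)
      shift = solve-∀
      B≋-1-c : + B ≋ - + suc c
      B≋-1-c = ≋-by 1ℤ (trans (cong (_- - + suc c) (sym (pos-∸ c≤p-1))) (shift (+ p-1) (+ c)))

  -- Reduction of p-integral rationals

  p∤-* : ∀ {m n} → ¬ (p ∣ m) → ¬ (p ∣ n) → ¬ (p ∣ m ℕ.* n)
  p∤-* {m} {n} p∤m p∤n p∣mn with euclidsLemma m n p-prime p∣mn
  ... | inj₁ p∣m = p∤m p∣m
  ... | inj₂ p∣n = p∤n p∣n

  record IsResidueᵘ (w : ℤ) (x : ℚᵘ) : Set where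
    constructor residue
    field
      p∤denominator : ¬ (p ∣ ℚᵘ.denominatorℕ x)
      w*denominator≋numerator : w * ℚᵘ.denominator x ≋ ℚᵘ.numerator x

  IsResidue : ℤ → ℚ → Set
  IsResidue w x = IsResidueᵘ w (ℚ.toℚᵘ x)

  redℚ-residue : ∀ {w} x → IsResidue w x → redℚ p x ≋ w
  redℚ-residue (mkℚ n d-1 _) (residue p∤d w*d≋n) =
    *-cancelʳ-≋ d≉0 (≋-trans red*d≋n (≋-sym w*d≋n))
    where
      d = suc d-1
      d≉0 : + d ≉ 0ℤ
      d≉0 d≋0 = p∤d (≋0⇒∣ d≋0)
      red*d≋n : n * + (d ℕ.^ p-2) * + d ≋ n
      red*d≋n = begin
        n * + (d ℕ.^ p-2) * + d    ≡⟨ ℤP.*-assoc n _ _ ⟩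
        n * (+ (d ℕ.^ p-2) * + d)  ≡⟨ cong (λ e → n * (e * + d)) (pos-^ d p-2) ⟩
        n * ((+ d) ^ p-2 * + d)    ≡⟨ cong (n *_) (ℤP.*-comm ((+ d) ^ p-2) (+ d)) ⟩
        n * (+ d) ^ p-1            ≈⟨ *-congˡ n (fermat-≉0 d≉0) ⟩
        n * 1ℤ                     ≡⟨ ℤP.*-identityʳ n ⟩
        n                          ∎
        where open SetoidReasoning ≋-setoid

  IsResidueᵘ-≃ : ∀ {w x y} → IsResidueᵘ w x → x ≃ y → ¬ (p ∣ ℚᵘ.denominatorℕ y) → IsResidueᵘ w y
  IsResidueᵘ-≃ {w} {mkℚᵘ m e-1} {mkℚᵘ n d-1} (residue p∤e w*e≋m) (*≡* m*d≡n*e) p∤d = residue p∤d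
    (*-cancelʳ-≋ (λ e≋0 → p∤e (≋0⇒∣ e≋0))
      (≋-trans (≡⇒≋ (swap w (+ suc d-1) (+ suc e-1))) (≋-trans (*-congʳ (+ suc d-1) w*e≋m) (≡⇒≋ m*d≡n*e))))
    where swap : ∀ w d e → w * d * e ≡ w * e * d
          swap = solve-∀

  IsResidue-fromᵘ : ∀ {w y} z → IsResidueᵘ w y → y ≃ ℚ.toℚᵘ z → IsResidue w z
  IsResidue-fromᵘ {w} {y} z@(mkℚ _ _ _) w≡y y≃z = IsResidueᵘ-≃ w≡y y≃z (λ p∣dz →
    IsResidueᵘ.p∤denominator w≡y (ℕD.∣-trans p∣dz (toℚᵘ-≃⇒denominator-∣ z y (ℚᵘP.≃-sym y≃z))))

  IsResidueᵘ-cong : ∀ {w w′ x} → w ≋ w′ → IsResidueᵘ w x → IsResidueᵘ w′ x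
  IsResidueᵘ-cong {x = mkℚᵘ n d-1} w≋w′ (residue p∤d w*d≋n) =
    residue p∤d (≋-trans (*-congʳ (+ suc d-1) (≋-sym w≋w′)) w*d≋n)

  IsResidueᵘ-+ : ∀ {w v x y} → IsResidueᵘ w x → IsResidueᵘ v y → IsResidueᵘ (w + v) (x ℚᵘ.+ y)
  IsResidueᵘ-+ {w} {v} {mkℚᵘ m e-1} {mkℚᵘ n d-1} (residue p∤e w*e≋m) (residue p∤d v*d≋n) =
    residue (p∤-* p∤e p∤d) (≋-trans
      (≡⇒≋ (trans (cong ((w + v) *_) (ℤP.pos-* (suc e-1) (suc d-1))) (distrib w v (+ suc e-1) (+ suc d-1))))
      (+-cong (*-congʳ (+ suc d-1) w*e≋m) (*-congʳ (+ suc e-1) v*d≋n)))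
    where distrib : ∀ w v e d → (w + v) * (e * d) ≡ w * e * d + v * d * e
          distrib = solve-∀

  IsResidueᵘ-* : ∀ {w v x y} → IsResidueᵘ w x → IsResidueᵘ v y → IsResidueᵘ (w * v) (x ℚᵘ.* y)
  IsResidueᵘ-* {w} {v} {mkℚᵘ m e-1} {mkℚᵘ n d-1} (residue p∤e w*e≋m) (residue p∤d v*d≋n) =
    residue (p∤-* p∤e p∤d) (≋-trans
      (≡⇒≋ (trans (cong ((w * v) *_) (ℤP.pos-* (suc e-1) (suc d-1))) (regroup w v (+ suc e-1) (+ suc d-1))))
      (*-cong w*e≋m v*d≋n))
    where regroup : ∀ w v e d → (w * v) * (e * d) ≡ w * e * (v * d)
          regroup = solve-∀

  IsResidueᵘ-neg : ∀ {w x} → IsResidueᵘ w x → IsResidueᵘ (- w) (ℚᵘ.- x)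
  IsResidueᵘ-neg {w} {mkℚᵘ n d-1} (residue p∤d w*d≋n) =
    residue p∤d (≋-trans (≡⇒≋ (sym (ℤP.neg-distribˡ-* w (+ suc d-1)))) (neg-cong w*d≋n))

  IsResidue-+ : ∀ {w v} x y → IsResidue w x → IsResidue v y → IsResidue (w + v) (x ℚ.+ y)
  IsResidue-+ x y w≡x v≡y = IsResidue-fromᵘ (x ℚ.+ y) (IsResidueᵘ-+ w≡x v≡y) (ℚᵘP.≃-sym (ℚP.toℚᵘ-homo-+ x y))

  IsResidue-* : ∀ {w v} x y → IsResidue w x → IsResidue v y → IsResidue (w * v) (x ℚ.* y)
  IsResidue-* x y w≡x v≡y = IsResidue-fromᵘ (x ℚ.* y) (IsResidueᵘ-* w≡x v≡y) (ℚᵘP.≃-sym (ℚP.toℚᵘ-homo-* x y))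

  IsResidue-neg : ∀ {w} x → IsResidue w x → IsResidue (- w) (ℚ.- x)
  IsResidue-neg x w≡x = IsResidue-fromᵘ (ℚ.- x) (IsResidueᵘ-neg w≡x) (ℚᵘP.≃-sym (ℚP.toℚᵘ-homo‿- x))

  IsResidue-/ : ∀ i n .{{_ : ℕ.NonZero n}} w → ¬ (p ∣ n) → w * + n ≋ i → IsResidue w (i ℚ./ n)
  IsResidue-/ i (suc n-1) w p∤n w*n≋i =
    IsResidue-fromᵘ (i ℚ./ suc n-1) (residue p∤n w*n≋i) (ℚᵘP.≃-sym (ℚP.toℚᵘ-fromℚᵘ (mkℚᵘ i n-1)))

  IsResidue-1 : IsResidue 1ℤ 1ℚ
  IsResidue-1 = residue (ℕD.>⇒∤ (s≤s (s≤s z≤n))) ≋-refl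

  IsResidue-poch : ∀ {w} x → IsResidue w x → ∀ k → IsResidue (rising w k) (poch x k)
  IsResidue-poch x w≡x zero    = IsResidue-1
  IsResidue-poch {w} x w≡x (suc k) = IsResidue-* (poch x k) (x ℚ.+ (+ k ℚ./ 1))
    (IsResidue-poch x w≡x k)
    (IsResidue-+ x (+ k ℚ./ 1) w≡x (IsResidue-/ (+ k) 1 (+ k) (ℕD.>⇒∤ (s≤s (s≤s z≤n))) (≡⇒≋ (ℤP.*-identityʳ (+ k)))))

  IsResidue-Aγ : ∀ {w} γ → IsResidue w (ℚ.- γ) → ∀ k → k ℕ.< p →
    IsResidue (rising w k * (+ (k !)) ^ p-2) (Aγ γ k)
  IsResidue-Aγ γ w≡-γ k k<p = IsResidue-* (poch (ℚ.- γ) k) _ (IsResidue-poch (ℚ.- γ) w≡-γ k)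
    (IsResidue-/ 1ℤ (k !) {{k ℕP.!≢0}} ((+ (k !)) ^ p-2) (λ p∣k! → !-≉0 k k<p (∣⇒≋0 p∣k!))
      (≋-trans (≡⇒≋ (ℤP.*-comm ((+ (k !)) ^ p-2) (+ (k !)))) (fermat-≉0 (!-≉0 k k<p))))

  fraction-residue : ∀ x K → ℚ.toℚᵘ x ≃ mkℚᵘ K p-2 → IsResidue (- K) x
  fraction-residue x K x≃K/p-1 = IsResidue-fromᵘ x
    (residue (ℕD.>⇒∤ (ℕP.n<1+n p-1)) (≋-by (- K) (regroup K (+ p-1))))
    (ℚᵘP.≃-sym x≃K/p-1)
    where regroup : ∀ K a → - K * a - K ≡ - K * (1ℤ + a)
          regroup = solve-∀

  expo-fraction : ∀ x K → ℚ.toℚᵘ x ≃ mkℚᵘ K p-2 → expo p x ≡ K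
  expo-fraction x K = numerator-scaled x K p-2

  inverse-unique : ∀ {z w} → z * w ≋ 1ℤ → z ^ p-2 ≋ w
  inverse-unique {z} {w} zw≋1 = begin
    z ^ p-2              ≡⟨ sym (ℤP.*-identityʳ (z ^ p-2)) ⟩
    z ^ p-2 * 1ℤ         ≈⟨ *-congˡ (z ^ p-2) (≋-sym zw≋1) ⟩
    z ^ p-2 * (z * w)    ≡⟨ regroup (z ^ p-2) z w ⟩
    z ^ p-1 * w          ≈⟨ *-congʳ w (fermat-≉0 z≉0) ⟩
    1ℤ * w               ≡⟨ ℤP.*-identityˡ w ⟩
    w                    ∎
    where
      open SetoidReasoning ≋-setoid
      regroup : ∀ i z w → i * (z * w) ≡ z * i * w
      regroup = solve-∀
      z≉0 : z ≉ 0ℤ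
      z≉0 z≋0 = pos-≉0 (s≤s z≤n) (s≤s (s≤s z≤n))
        (≋-trans (≋-sym zw≋1) (≋-trans (*-congʳ w z≋0) (≡⇒≋ (ℤP.*-zeroˡ w))))

  factorials-cancel : ∀ {a c u v N} → a ℕ.< p → c ℕ.< p →
    u * + (a !) * + (c !) ≋ N → v * + (a !) * + (c !) ≋ N → u ≋ v
  factorials-cancel {a} {c} {u} {v} a<p c<p u≋N v≋N =
    *-cancelʳ-≋ (*-≉0 (!-≉0 a a<p) (!-≉0 c c<p))
      (≋-trans (≡⇒≋ (sym (ℤP.*-assoc u _ _)))
               (≋-trans u≋N (≋-trans (≋-sym v≋N) (≡⇒≋ (ℤP.*-assoc v _ _)))))

  module BinomialCongruences
    (x y : ℚ) (a c : ℕ) (1≤a : 1 ℕ.≤ a) (1≤c : 1 ℕ.≤ c) (a+c≤p-1 : a ℕ.+ c ℕ.≤ p-1)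
    (x≃a/p-1 : ℚ.toℚᵘ x ≃ mkℚᵘ (+ a) p-2) (y≃b/p-1 : ℚ.toℚᵘ y ≃ mkℚᵘ (+ (a ℕ.+ c)) p-2)
    where

    a≤p-1 : a ℕ.≤ p-1
    a≤p-1 = ℕP.m+n≤o⇒m≤o a a+c≤p-1

    c≤p-1 : c ℕ.≤ p-1
    c≤p-1 = ℕP.m+n≤o⇒n≤o a a+c≤p-1

    y-x≃c/p-1 : ℚ.toℚᵘ (y ℚ.- x) ≃ mkℚᵘ (+ c) p-2
    y-x≃c/p-1 = ℚᵘP.≃-trans (ℚP.toℚᵘ-homo-+ y (ℚ.- x))
      (ℚᵘP.≃-trans (ℚᵘP.+-cong y≃b/p-1 (ℚᵘP.≃-trans (ℚP.toℚᵘ-homo‿- x) (ℚᵘP.-‿cong x≃a/p-1)))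
        (ℚᵘP.≃-trans (fraction-sub (+ (a ℕ.+ c)) (+ a) p-2)
          (ℚᵘP.≃-reflexive (cong (λ K → mkℚᵘ K p-2) b-a≡c))))
      where
        cancel : ∀ a c → a + c - a ≡ c
        cancel = solve-∀
        b-a≡c : + (a ℕ.+ c) - + a ≡ + c
        b-a≡c = trans (cong (_- + a) (ℤP.pos-+ a c)) (cancel (+ a) (+ c))

    γ : ℚ
    γ = ℚ.- 1ℚ ℚ.+ y ℚ.- x

    -γ-residue : IsResidue (+ suc c) (ℚ.- γ)
    -γ-residue = IsResidueᵘ-cong (≡⇒≋ -γ≡1+c)
      (IsResidue-neg γ (IsResidue-+ (ℚ.- 1ℚ ℚ.+ y) (ℚ.- x)
        (IsResidue-+ (ℚ.- 1ℚ) y (IsResidue-neg 1ℚ IsResidue-1) (fraction-residue y _ y≃b/p-1))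
        (IsResidue-neg x (fraction-residue x _ x≃a/p-1))))
      where
        simplify : ∀ a c → - (- 1ℤ + - (a + c) + - - a) ≡ 1ℤ + c
        simplify = solve-∀
        -γ≡1+c : - (- 1ℤ + - + (a ℕ.+ c) + - - + a) ≡ + suc c
        -γ≡1+c = trans (cong (λ b → - (- 1ℤ + - b + - - + a)) (ℤP.pos-+ a c)) (simplify (+ a) (+ c))

    Aγ-binomial : redℚ p (Aγ γ a) * + (a !) * + (c !) ≋ + ((c ℕ.+ a) !)
    Aγ-binomial = begin
      redℚ p (Aγ γ a) * + (a !) * + (c !)
        ≈⟨ *-congʳ (+ (c !)) (*-congʳ (+ (a !))
             (redℚ-residue (Aγ γ a) (IsResidue-Aγ γ -γ-residue a (s≤s a≤p-1)))) ⟩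
      rising (+ suc c) a * (+ (a !)) ^ p-2 * + (a !) * + (c !)
        ≡⟨ regroup (rising (+ suc c) a) ((+ (a !)) ^ p-2) (+ (a !)) (+ (c !)) ⟩
      (+ (a !)) ^ p-1 * (rising (+ suc c) a * + (c !))
        ≈⟨ *-cong (fermat-≉0 (!-≉0 a (s≤s a≤p-1))) (≡⇒≋ (rising-factorial c a)) ⟩
      1ℤ * + ((c ℕ.+ a) !)
        ≡⟨ ℤP.*-identityˡ _ ⟩
      + ((c ℕ.+ a) !) ∎
      where
        open SetoidReasoning ≋-setoid
        regroup : ∀ r i f g → r * i * f * g ≡ f * i * (r * g)
        regroup = solve-∀

    Γ-quotient : ℤ
    Γ-quotient = Γpmod p x * Γpmod p (y ℚ.- x) * invmod p (Γpmod p y)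

    Γ-binomial : Γ-quotient * + (a !) * + (c !) ≋ + ((c ℕ.+ a) !)
    Γ-binomial = begin
      Γx * Γy-x * Γy ^ p-2 * + (a !) * + (c !)
        ≡⟨ regroup Γx Γy-x (Γy ^ p-2) (+ (a !)) (+ (c !)) ⟩
      Γx * + (a !) * (Γy-x * + (c !)) * Γy ^ p-2
        ≈⟨ *-cong (*-cong (Γpmod-reflection x a a≤p-1 (residue-of x a x≃a/p-1))
                          (Γpmod-reflection (y ℚ.- x) c c≤p-1 (residue-of (y ℚ.- x) c y-x≃c/p-1)))
                  (inverse-unique (Γpmod-reflection y (a ℕ.+ c) a+c≤p-1 (residue-of y (a ℕ.+ c) y≃b/p-1))) ⟩
      1ℤ * 1ℤ * + ((a ℕ.+ c) !)
        ≡⟨ trans (ℤP.*-identityˡ _) (cong (λ n → + (n !)) (ℕP.+-comm a c)) ⟩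
      + ((c ℕ.+ a) !) ∎
      where
        open SetoidReasoning ≋-setoid
        Γx = Γpmod p x
        Γy-x = Γpmod p (y ℚ.- x)
        Γy = Γpmod p y
        regroup : ∀ u v w f g → u * v * w * f * g ≡ u * f * (v * g) * w
        regroup = solve-∀
        residue-of : ∀ z k → ℚ.toℚᵘ z ≃ mkℚᵘ (+ k) p-2 → redℚ p z ≋ - + k
        residue-of z k z≃ = redℚ-residue z (fraction-residue z (+ k) z≃)

    J : ℤ
    J = Jmod p x (y ℚ.- x)

    J-binomial : - J * + (a !) * + (c !) ≋ + ((c ℕ.+ a) !)
    J-binomial = ≋-trans (*-congʳ (+ (c !)) (*-congʳ (+ (a !)) -J≋coef)) (C-reflection a c c≤p-1)
      where
        a≤p-2 : a ℕ.≤ p-2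
        a≤p-2 = ℕP.≤-pred (ℕP.<-≤-trans (ℕP.m<m+n a 1≤c) a+c≤p-1)
        c≤p-2 : c ℕ.≤ p-2
        c≤p-2 = ℕP.≤-pred (ℕP.<-≤-trans (ℕP.m<n+m c 1≤a) a+c≤p-1)
        J≋beta : J ≋ sumTo p (λ t → (+ t) ^ (p-1 ∸ a) * (1ℤ - + t) ^ (p-1 ∸ c))
        J≋beta = subst₂ (λ e f → sumTo p (λ t → ω̄pow p e (+ t) * ω̄pow p f (1ℤ - + t)) ≋ _)
          (sym (expo-fraction x (+ a) x≃a/p-1)) (sym (expo-fraction (y ℚ.- x) (+ c) y-x≃c/p-1))
          (sumTo-cong≋ p (λ t _ → *-cong (ω̄pow-≋ a (+ t) a≤p-2) (ω̄pow-≋ c (1ℤ - + t) c≤p-2)))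
        -J≋coef : - J ≋ + ((p-1 ∸ c) C a) * -1ℤ ^ a
        -J≋coef = ≋-trans (neg-cong (≋-trans J≋beta (beta-sum a c 1≤c a+c≤p-1)))
                          (≡⇒≋ (ℤP.neg-involutive _))

    congruences : (redℚ p (Aγ γ (ℤ.∣ expo p x ∣)) ≡ Γ-quotient [mod p ]) × (Γ-quotient ≡ - J [mod p ])
    congruences =
        ≋⇒≡[mod] (factorials-cancel {a} {c} {redℚ p (Aγ γ (ℤ.∣ expo p x ∣))} {Γ-quotient} a<p c<p
                    Aγ-binomial′ Γ-binomial)
      , ≋⇒≡[mod] (factorials-cancel {a} {c} {Γ-quotient} { - J} a<p c<p Γ-binomial J-binomial)
      where
        a<p = s≤s a≤p-1
        c<p = s≤s c≤p-1
        Aγ-binomial′ : redℚ p (Aγ γ (ℤ.∣ expo p x ∣)) * + (a !) * + (c !) ≋ + ((c ℕ.+ a) !)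
        Aγ-binomial′ = subst (λ e → redℚ p (Aγ γ ℤ.∣ e ∣) * + (a !) * + (c !) ≋ + ((c ℕ.+ a) !))
                             (sym (expo-fraction x (+ a) x≃a/p-1)) Aγ-binomial

  positive-fraction : ∀ x → 0ℚ ℚ.< x → ℚ.denominatorℕ x ∣ p-1 →
    Σ ℕ λ a → 1 ℕ.≤ a × ℚ.toℚᵘ x ≃ mkℚᵘ (+ a) p-2
  positive-fraction x 0<x den∣p-1 with fraction-over x p-2 den∣p-1
  ... | K , x≃K with <-over-fractions (0ℚ≃0/m p-2) x≃K 0<x
  ... | ℤ.+<+ 0<a = _ , 0<a , x≃K

  theorem : ∀ x y → 0ℚ ℚ.< x → x ℚ.< y → y ℚ.≤ 1ℚ →
    ℚ.denominatorℕ x ∣ p-1 → ℚ.denominatorℕ y ∣ p-1 →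
    (redℚ p (Aγ (ℚ.- 1ℚ ℚ.+ y ℚ.- x) (ℤ.∣ expo p x ∣))
       ≡ Γpmod p x * Γpmod p (y ℚ.- x) * invmod p (Γpmod p y) [mod p ])
    × (Γpmod p x * Γpmod p (y ℚ.- x) * invmod p (Γpmod p y) ≡ - Jmod p x (y ℚ.- x) [mod p ])
  theorem x y 0<x x<y y≤1 den-x∣p-1 den-y∣p-1 =
    BinomialCongruences.congruences x y a (b ∸ a) 1≤a (ℕP.m<n⇒0<n∸m a<b)
      (subst (ℕ._≤ p-1) (sym a+[b-a]≡b) b≤p-1)
      x≃a/p-1 (subst (λ n → ℚ.toℚᵘ y ≃ mkℚᵘ (+ n) p-2) (sym a+[b-a]≡b) y≃b/p-1)
    where
      x-fraction = positive-fraction x 0<x den-x∣p-1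
      y-fraction = positive-fraction y (ℚP.<-trans 0<x x<y) den-y∣p-1
      a = proj₁ x-fraction
      b = proj₁ y-fraction
      1≤a : 1 ℕ.≤ a
      1≤a = proj₁ (proj₂ x-fraction)
      x≃a/p-1 : ℚ.toℚᵘ x ≃ mkℚᵘ (+ a) p-2
      x≃a/p-1 = proj₂ (proj₂ x-fraction)
      y≃b/p-1 : ℚ.toℚᵘ y ≃ mkℚᵘ (+ b) p-2
      y≃b/p-1 = proj₂ (proj₂ y-fraction)
      a<b : a ℕ.< b
      a<b = ℤP.drop‿+<+ (<-over-fractions x≃a/p-1 y≃b/p-1 x<y)
      b≤p-1 : b ℕ.≤ p-1
      b≤p-1 = ℤP.drop‿+≤+ (≤-over-fractions y≃b/p-1 (1ℚ≃m/m p-2) y≤1)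
      a+[b-a]≡b : a ℕ.+ (b ∸ a) ≡ b
      a+[b-a]≡b = ℕP.m+[n∸m]≡n (ℕP.<⇒≤ a<b)

denominator∣Mof : ∀ xs x ys → ℚ.denominatorℕ x ∣ Mof (xs ++ x ∷ ys)
denominator∣Mof []       x ys = m∣lcm[m,n] (ℚ.denominatorℕ x) (Mof ys)
denominator∣Mof (y ∷ xs) x ys =
  ℕD.∣-trans (denominator∣Mof xs x ys) (n∣lcm[m,n] (ℚ.denominatorℕ y) (Mof (xs ++ x ∷ ys)))

lemma3p10 : (m : ℕ) → m ≡ 2 ⊎ m ≡ 3 →
  (r : Fin m → ℚ) (rn qn : ℚ) →
  (∀ i → 0ℚ ℚ.< r i) → (∀ i j → i ≤ j → r i ℚ.≤ r j) → (∀ i → r i ℚ.< 1ℚ) →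
  0ℚ ℚ.< rn → rn ℚ.< qn → qn ℚ.≤ 1ℚ →
  (∀ i → toℕ i ≡ 1 → r i ℚ.< qn) →
  (p : ℕ) → Prime p →
  Mof ((toList r ++ rn ∷ []) ++ (replicate m 1ℚ ++ qn ∷ [])) ∣ p ∸ 1 →
  (redℚ p (Aγ (ℚ.- 1ℚ ℚ.+ qn ℚ.- rn) (ℤ.∣ expo p rn ∣))
     ≡ Γpmod p rn ℤ.* Γpmod p (qn ℚ.- rn) ℤ.* invmod p (Γpmod p qn) [mod p ])
  × (Γpmod p rn ℤ.* Γpmod p (qn ℚ.- rn) ℤ.* invmod p (Γpmod p qn)
     ≡ ℤ.- Jmod p rn (qn ℚ.- rn) [mod p ])
lemma3p10 _ _ _ _ _ _ _ _ _ _ _ _ 0             p-prime _ = ⊥-elim (¬prime[0] p-prime)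
lemma3p10 _ _ _ _ _ _ _ _ _ _ _ _ 1             p-prime _ = ⊥-elim (¬prime[1] p-prime)
lemma3p10 m _ r rn qn _ _ _ 0<rn rn<qn qn≤1 _ (suc (suc p-2)) p-prime M∣p-1 =
  ModPrime.theorem p-2 p-prime rn qn 0<rn rn<qn qn≤1
    (ℕD.∣-trans (subst (λ l → ℚ.denominatorℕ rn ∣ Mof l) (sym (++-assoc (toList r) (rn ∷ []) β))
                       (denominator∣Mof (toList r) rn β)) M∣p-1)
    (ℕD.∣-trans (subst (λ l → ℚ.denominatorℕ qn ∣ Mof l) (++-assoc α (replicate m 1ℚ) (qn ∷ []))
                       (denominator∣Mof (α ++ replicate m 1ℚ) qn [])) M∣p-1)
  where
    α = toList r ++ rn ∷ []
    β = replicate m 1ℚ ++ qn ∷ []
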